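{- Let $G$ be a graph, let $b$ be an orientable balanced valuation on $G$, and let $S\subseteq V(G)$ with $\partial(S)\neq 0$ be such that $\phi(S,b)=\phi(b)$. Assume that $S$ can be partitioned into two nonempty sets $A,B$ with $\partial(A)\neq 0$ and $\partial(B)\neq 0$ such that there is no edge between $A$ and $B$. Then $\phi(A,b)=\phi(B,b)=\phi(b)$.
   Context: For $S\subseteq V(G)$, $\partial(S)$ denotes the number of edges with exactly one end in $S$, and for $b:V(G)\to\mathbb{Z}$, $b(S)=\sum_{v\in S}b(v)$. A balanced valuation of $G$ is a map $b:V(G)\to\mathbb{Z}$ such that $b(S)\le\partial(S)$ for every $S\subseteq V(G)$ and $b(v)\equiv\partial(\{v\})\pmod 2$ for every vertex $v$. It is orientable if $b(S)<\partial(S)$ for every $S\subseteq V(G)$ with $\partial(S)\ne 0$. For such $S$ define $\phi(S,b)=\frac{\partial(S)+b(S)}{\partial(S)-b(S)}+1$, and $\phi(b)=\max\{\phi(S,b): S\subseteq V(G),\ \partial(S)\neq 0\}$. -}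

module Defs where

open import Data.Bool using (Bool; true; false; if_then_else_; _xor_; _∧_)
open import Data.Nat as ℕ using (ℕ; zero; suc)
open import Data.Integer as ℤ using (ℤ; +_; _-_; _≤_; _<_)
open import Data.Integer.Divisibility using (_∣_)
open import Data.Fin using (Fin)
open import Data.Fin.Subset using (Subset; ⁅_⁆)
open import Data.Vec using (Vec; []; _∷_; lookup)
open import Data.List using (List; []; _∷_; map; _++_; foldr; allFin)
open import Data.Product using (_×_; _,_)
open import Data.Rational as ℚ using (ℚ; 0ℚ; 1ℚ)
open import Relation.Binary.PropositionalEquality using (_≢_)

-- A finite (multi)graph: vertices Fin n, edges a list of (unordered) pairs of ends.
-- Loops and parallel edges allowed.
record Graph : Set where
  field
    n     : ℕ
    edges : List (Fin n × Fin n)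
open Graph public

∂ : (G : Graph) → Subset (n G) → ℕ
∂ G S = go (edges G)
  where
  go : List (Fin (n G) × Fin (n G)) → ℕ
  go [] = 0
  go ((u , v) ∷ es) = if lookup S u xor lookup S v then suc (go es) else go es

∂ℤ : (G : Graph) → Subset (n G) → ℤ
∂ℤ G S = + ∂ G S

bsum : (G : Graph) → (Fin (n G) → ℤ) → Subset (n G) → ℤ
bsum G b S = foldr (λ v acc → (if lookup S v then b v else + 0) ℤ.+ acc) (+ 0) (allFin (n G))

IsBalancedValuation : (G : Graph) → (Fin (n G) → ℤ) → Set
IsBalancedValuation G b =
  ((S : Subset (n G)) → bsum G b S ≤ ∂ℤ G S) ×
  ((v : Fin (n G)) → (+ 2) ∣ (b v - ∂ℤ G ⁅ v ⁆))

IsOrientable : (G : Graph) → (Fin (n G) → ℤ) → Set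
IsOrientable G b = (S : Subset (n G)) → ∂ G S ≢ 0 → bsum G b S < ∂ℤ G S

-- φ(S,b) = (∂(S)+b(S))/(∂(S)-b(S)) + 1.  The denominator is taken as the
-- natural number |∂(S)-b(S)|, which equals ∂(S)-b(S) whenever b is orientable
-- and ∂(S) ≠ 0 (the only case in which φ(S,b) is defined in the paper);
-- if it is 0 we return 0 (junk value, never used).
φS : (G : Graph) → (Fin (n G) → ℤ) → Subset (n G) → ℚ
φS G b S with ℤ.∣ ∂ℤ G S - bsum G b S ∣
... | zero  = 0ℚ
... | suc d = ((∂ℤ G S ℤ.+ bsum G b S) ℚ./ suc d) ℚ.+ 1ℚ

allSubsets : (k : ℕ) → List (Subset k)
allSubsets zero    = [] ∷ []
allSubsets (suc k) = map (true ∷_) (allSubsets k) ++ map (false ∷_) (allSubsets k)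

-- φ(b) = max { φ(S,b) : ∂(S) ≠ 0 }.  Values φ(S,b) with ∂(S)≠0 are positive
-- for orientable b, so starting the max at 0 does not change it when some S
-- with ∂(S) ≠ 0 exists.
φ : (G : Graph) → (Fin (n G) → ℤ) → ℚ
φ G b = foldr step 0ℚ (allSubsets (n G))
  where
  step : Subset (n G) → ℚ → ℚ
  step S acc with ∂ G S
  ... | zero  = acc
  ... | suc _ = φS G b S ℚ.⊔ acc

{-# OPTIONS --safe #-}
-- Write φ(X,b) = 1 + N(X)/D(X) with N = ∂ + b and D = ∂ − b; orientability makes D(X) positive.
-- With no edge between A and B, both ∂ and b are additive on S = A ∪ B, so N(S)/D(S) is the
-- mediant of N(A)/D(A) and N(B)/D(B) and therefore lies between them. As φ(S,b) = φ(b) is at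
-- least φ(A,b) and φ(B,b), the mediant dominates both fractions, which forces all three to agree.
module Submission where

open import Defs
import Algebra.Properties.CommutativeSemigroup as CommSemigroup
open import Data.Bool using (Bool; true; false; if_then_else_; _xor_; _∧_; _∨_)
open import Data.Empty using (⊥-elim)
open import Data.Fin using (Fin)
open import Data.Fin.Subset using (Subset; _∩_; _∪_; _∈_; Nonempty; Empty)
open import Data.Fin.Subset.Properties using (x∈p∩q⁺; ∪-comm; ∩-comm)
open import Data.Integer as ℤ using (ℤ; +_)
import Data.Integer.Properties as ℤ
open import Data.Integer.Solver using (module +-*-Solver)
open import Data.List using (List; []; _∷_; foldr; map; allFin)
open import Data.List.Membership.Propositional renaming (_∈_ to _∈ₗ_)
open import Data.List.Membership.Propositional.Properties using (∈-++⁺ˡ; ∈-++⁺ʳ; ∈-map⁺)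
open import Data.List.Relation.Unary.Any using (here; there)
open import Data.Nat as ℕ using (ℕ; zero; suc)
import Data.Nat.Properties as ℕ
open import Data.Product using (_×_; _,_; Σ; ∃; proj₁)
open import Data.Rational as ℚ using (ℚ; 0ℚ; 1ℚ; fromℚᵘ)
import Data.Rational.Properties as ℚ
open import Algebra.Properties.Group ℚ.+-0-group using (//-rightDividesʳ)
open import Data.Rational.Unnormalised as ℚᵘ using (mkℚᵘ; *≤*)
import Data.Rational.Unnormalised.Properties as ℚᵘ
open import Data.Sum using (_⊎_; inj₁; inj₂; swap)
open import Data.Vec using (lookup; []; _∷_)
open import Data.Vec.Properties using (lookup-zipWith; lookup⇒[]=)
open import Function using (_∘_)
open import Relation.Nullary using (¬_)
open import Relation.Binary.PropositionalEquality
  using (_≡_; _≢_; refl; sym; trans; cong; cong₂; subst; subst₂; module ≡-Reasoning)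

private variable
  k : ℕ
  A B : Subset k

∪-lookup : ∀ (A B : Subset k) x → lookup (A ∪ B) x ≡ lookup A x ∨ lookup B x
∪-lookup A B x = lookup-zipWith _∨_ x A B

¬both⇒∧≡false : ∀ {x y : Fin k} → ¬ (x ∈ A × y ∈ B) → lookup A x ∧ lookup B y ≡ false
¬both⇒∧≡false {A = A} {B} {x} {y} ¬both with lookup A x in eqA | lookup B y in eqB
... | false | _     = refl
... | true  | false = refl
... | true  | true  = ⊥-elim (¬both (lookup⇒[]= x A eqA , lookup⇒[]= y B eqB))

disjoint⇒∧≡false : Empty (A ∩ B) → ∀ x → lookup A x ∧ lookup B x ≡ false
disjoint⇒∧≡false A∩B≡∅ x = ¬both⇒∧≡false (λ x∈A×x∈B → A∩B≡∅ (x , x∈p∩q⁺ x∈A×x∈B))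

crossings : Subset k → List (Fin k × Fin k) → ℕ
crossings S [] = 0
crossings S ((u , v) ∷ es) = if lookup S u xor lookup S v then suc (crossings S es) else crossings S es

crossings-unique : (S : Subset k) {count : List (Fin k × Fin k) → ℕ} → count [] ≡ 0 →
  (∀ u v es → count ((u , v) ∷ es) ≡ (if lookup S u xor lookup S v then suc (count es) else count es)) →
  ∀ es → count es ≡ crossings S es
crossings-unique S nil cons [] = nil
crossings-unique S {count} nil cons ((u , v) ∷ es)
  rewrite cons u v es | crossings-unique S {count} nil cons es = refl

-- `∂` recurses through a function local to its where block; abstracting `edges G` lets
-- unification solve `count` with that function.
∂≡crossings : (G : Graph) (S : Subset (n G)) → ∂ G S ≡ crossings S (edges G)
∂≡crossings G S with edges G | crossings-unique S refl (λ _ _ _ → refl)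
... | es | count≡crossings = count≡crossings es

toℕ : Bool → ℕ
toℕ false = 0
toℕ true  = 1

crossings-∷ : ∀ (S : Subset k) u v es →
  crossings S ((u , v) ∷ es) ≡ toℕ (lookup S u xor lookup S v) ℕ.+ crossings S es
crossings-∷ S u v es with lookup S u xor lookup S v
... | true  = refl
... | false = refl

xor-∨-split : ∀ a b c d → a ∧ b ≡ false → c ∧ d ≡ false → a ∧ d ≡ false → b ∧ c ≡ false →
  toℕ ((a ∨ b) xor (c ∨ d)) ≡ toℕ (a xor c) ℕ.+ toℕ (b xor d)
xor-∨-split true  true  _     _     () _  _  _
xor-∨-split _     _     true  true  _  () _  _
xor-∨-split true  _     _     true  _  _  () _
xor-∨-split _     true  true  _     _  _  _  ()
xor-∨-split true  false false false _  _  _  _ = refl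
xor-∨-split false true  false false _  _  _  _ = refl
xor-∨-split false false true  false _  _  _  _ = refl
xor-∨-split false false false true  _  _  _  _ = refl
xor-∨-split false false false false _  _  _  _ = refl
xor-∨-split true  false true  false _  _  _  _ = refl
xor-∨-split false true  false true  _  _  _  _ = refl

NoEdgeBetween : Subset k → Subset k → List (Fin k × Fin k) → Set
NoEdgeBetween A B es = ∀ {u v} → (u , v) ∈ₗ es → ¬ ((u ∈ A × v ∈ B) ⊎ (u ∈ B × v ∈ A))

crossings-∪ : ∀ es → Empty (A ∩ B) → NoEdgeBetween A B es →
  crossings (A ∪ B) es ≡ crossings A es ℕ.+ crossings B es
crossings-∪ [] _ _ = refl
crossings-∪ {A = A} {B} ((u , v) ∷ es) A∩B≡∅ separated = begin
  crossings (A ∪ B) ((u , v) ∷ es)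
    ≡⟨ crossings-∷ (A ∪ B) u v es ⟩
  toℕ (lookup (A ∪ B) u xor lookup (A ∪ B) v) ℕ.+ crossings (A ∪ B) es
    ≡⟨ cong₂ (λ p q → toℕ (p xor q) ℕ.+ crossings (A ∪ B) es) (∪-lookup A B u) (∪-lookup A B v) ⟩
  toℕ ((Au ∨ Bu) xor (Av ∨ Bv)) ℕ.+ crossings (A ∪ B) es
    ≡⟨ cong₂ ℕ._+_ (xor-∨-split Au Bu Av Bv (disjoint u) (disjoint v) (across inj₁) (across inj₂))
                   (crossings-∪ es A∩B≡∅ (separated ∘ there)) ⟩
  (toℕ (Au xor Av) ℕ.+ toℕ (Bu xor Bv)) ℕ.+ (crossings A es ℕ.+ crossings B es)
    ≡⟨ CommSemigroup.interchange ℕ.+-commutativeSemigroup (toℕ (Au xor Av)) (toℕ (Bu xor Bv)) _ _ ⟩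
  (toℕ (Au xor Av) ℕ.+ crossings A es) ℕ.+ (toℕ (Bu xor Bv) ℕ.+ crossings B es)
    ≡⟨ sym (cong₂ ℕ._+_ (crossings-∷ A u v es) (crossings-∷ B u v es)) ⟩
  crossings A ((u , v) ∷ es) ℕ.+ crossings B ((u , v) ∷ es) ∎
  where
  open ≡-Reasoning
  Au = lookup A u
  Av = lookup A v
  Bu = lookup B u
  Bv = lookup B v
  disjoint = disjoint⇒∧≡false A∩B≡∅
  across : ∀ {C D : Subset _} → (u ∈ C × v ∈ D → (u ∈ A × v ∈ B) ⊎ (u ∈ B × v ∈ A)) →
           lookup C u ∧ lookup D v ≡ false
  across side = ¬both⇒∧≡false (separated (here refl) ∘ side)

∂-∪ : (G : Graph) {A B : Subset (n G)} → Empty (A ∩ B) → NoEdgeBetween A B (edges G) →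
  ∂ G (A ∪ B) ≡ ∂ G A ℕ.+ ∂ G B
∂-∪ G {A} {B} A∩B≡∅ separated
  rewrite ∂≡crossings G (A ∪ B) | ∂≡crossings G A | ∂≡crossings G B =
  crossings-∪ (edges G) A∩B≡∅ separated

weight : (Fin k → ℤ) → Subset k → Fin k → ℤ
weight b S v = if lookup S v then b v else + 0

weightedSum : (Fin k → ℤ) → Subset k → List (Fin k) → ℤ
weightedSum b S = foldr (λ v acc → weight b S v ℤ.+ acc) (+ 0)

if-∨ : ∀ a c (x : ℤ) → a ∧ c ≡ false →
  (if a ∨ c then x else + 0) ≡ (if a then x else + 0) ℤ.+ (if c then x else + 0)
if-∨ true  true  x ()
if-∨ true  false x _ = sym (ℤ.+-identityʳ x)
if-∨ false true  x _ = sym (ℤ.+-identityˡ x)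
if-∨ false false x _ = refl

weightedSum-∪ : ∀ (b : Fin k → ℤ) vs → Empty (A ∩ B) →
  weightedSum b (A ∪ B) vs ≡ weightedSum b A vs ℤ.+ weightedSum b B vs
weightedSum-∪ b [] _ = refl
weightedSum-∪ {A = A} {B} b (v ∷ vs) A∩B≡∅ = begin
  weight b (A ∪ B) v ℤ.+ weightedSum b (A ∪ B) vs
    ≡⟨ cong₂ ℤ._+_ weight-∪ (weightedSum-∪ b vs A∩B≡∅) ⟩
  (weight b A v ℤ.+ weight b B v) ℤ.+ (weightedSum b A vs ℤ.+ weightedSum b B vs)
    ≡⟨ CommSemigroup.interchange ℤ.+-commutativeSemigroup (weight b A v) (weight b B v) _ _ ⟩
  (weight b A v ℤ.+ weightedSum b A vs) ℤ.+ (weight b B v ℤ.+ weightedSum b B vs) ∎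
  where
  open ≡-Reasoning
  weight-∪ : weight b (A ∪ B) v ≡ weight b A v ℤ.+ weight b B v
  weight-∪ = trans (cong (λ t → if t then b v else + 0) (∪-lookup A B v))
                   (if-∨ (lookup A v) (lookup B v) (b v) (disjoint⇒∧≡false A∩B≡∅ v))

bsum-∪ : (G : Graph) (b : Fin (n G) → ℤ) {A B : Subset (n G)} → Empty (A ∩ B) →
  bsum G b (A ∪ B) ≡ bsum G b A ℤ.+ bsum G b B
bsum-∪ G b = weightedSum-∪ b (allFin (n G))

allSubsets-complete : ∀ k (S : Subset k) → S ∈ₗ allSubsets k
allSubsets-complete zero    [] = here refl
allSubsets-complete (suc k) (true ∷ S)  = ∈-++⁺ˡ (∈-map⁺ (true ∷_) (allSubsets-complete k S))
allSubsets-complete (suc k) (false ∷ S) =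
  ∈-++⁺ʳ (map (true ∷_) (allSubsets k)) (∈-map⁺ (false ∷_) (allSubsets-complete k S))

foldr-inflationary-≤ : ∀ {a} {X : Set a} {f : X → ℚ → ℚ} {x : X} {q z : ℚ} {xs : List X} →
  (∀ y acc → acc ℚ.≤ f y acc) → (∀ acc → q ℚ.≤ f x acc) → x ∈ₗ xs → q ℚ.≤ foldr f z xs
foldr-inflationary-≤ {f = f} {z = z} {y ∷ xs} _ q≤fx (here refl) = q≤fx (foldr f z xs)
foldr-inflationary-≤ {f = f} {z = z} {y ∷ xs} inflationary q≤fx (there x∈xs) =
  ℚ.≤-trans (foldr-inflationary-≤ inflationary q≤fx x∈xs) (inflationary y (foldr f z xs))

-- `φ` folds a step function local to its where block; unification recovers it.
φ-step : (G : Graph) → (Fin (n G) → ℤ) → Subset (n G) → ℚ → ℚ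
φ-step G b = proj₁ φ-as-foldr
  where
  φ-as-foldr : Σ (Subset (n G) → ℚ → ℚ) λ step → φ G b ≡ foldr step 0ℚ (allSubsets (n G))
  φ-as-foldr = _ , refl

φ-step-inflationary : ∀ G b S acc → acc ℚ.≤ φ-step G b S acc
φ-step-inflationary G b S acc with ∂ G S
... | zero  = ℚ.≤-refl
... | suc _ = ℚ.p≤q⊔p (φS G b S) acc

-- `with` also abstracts the `∂ G S` hidden inside `φS` on the left; the rewrite restores it.
φS≤φ-step : ∀ G b S acc → ∂ G S ≢ 0 → φS G b S ℚ.≤ φ-step G b S acc
φS≤φ-step G b S acc ∂S≢0 with ∂ G S in ∂S≡
... | zero  = ⊥-elim (∂S≢0 refl)
... | suc _ rewrite ∂S≡ = ℚ.p≤p⊔q _ acc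

φS≤φ : ∀ G b S → ∂ G S ≢ 0 → φS G b S ℚ.≤ φ G b
φS≤φ G b S ∂S≢0 = foldr-inflationary-≤
  (φ-step-inflationary G b) (λ acc → φS≤φ-step G b S acc ∂S≢0) (allSubsets-complete (n G) S)

mediant-cross : ∀ n₁ n₂ D₁ D₂ → n₂ ℤ.* (D₁ ℤ.+ D₂) ℤ.≤ (n₁ ℤ.+ n₂) ℤ.* D₂ →
  (n₁ ℤ.+ n₂) ℤ.* D₁ ℤ.≤ n₁ ℤ.* (D₁ ℤ.+ D₂)
mediant-cross n₁ n₂ D₁ D₂ hyp =
  subst₂ ℤ._≤_ (shiftˡ n₁ n₂ D₁ D₂) (shiftʳ n₁ n₂ D₁ D₂) (ℤ.+-monoˡ-≤ (n₁ ℤ.* D₁ ℤ.- n₂ ℤ.* D₂) hyp)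
  where
  open +-*-Solver
  shiftˡ : ∀ n₁ n₂ D₁ D₂ → n₂ ℤ.* (D₁ ℤ.+ D₂) ℤ.+ (n₁ ℤ.* D₁ ℤ.- n₂ ℤ.* D₂) ≡ (n₁ ℤ.+ n₂) ℤ.* D₁
  shiftˡ = solve 4 (λ n₁ n₂ D₁ D₂ → n₂ :* (D₁ :+ D₂) :+ (n₁ :* D₁ :- n₂ :* D₂) := (n₁ :+ n₂) :* D₁) refl
  shiftʳ : ∀ n₁ n₂ D₁ D₂ → (n₁ ℤ.+ n₂) ℤ.* D₂ ℤ.+ (n₁ ℤ.* D₁ ℤ.- n₂ ℤ.* D₂) ≡ n₁ ℤ.* (D₁ ℤ.+ D₂)
  shiftʳ = solve 4 (λ n₁ n₂ D₁ D₂ → (n₁ :+ n₂) :* D₂ :+ (n₁ :* D₁ :- n₂ :* D₂) := n₁ :* (D₁ :+ D₂)) refl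

mediant-≤ᵘ : ∀ n₁ n₂ d₁ d₂ d → suc d ≡ suc d₁ ℕ.+ suc d₂ →
  mkℚᵘ n₂ d₂ ℚᵘ.≤ mkℚᵘ (n₁ ℤ.+ n₂) d → mkℚᵘ (n₁ ℤ.+ n₂) d ℚᵘ.≤ mkℚᵘ n₁ d₁
mediant-≤ᵘ n₁ n₂ d₁ d₂ d d≡d₁+d₂ (*≤* hyp) =
  *≤* (subst (λ D → (n₁ ℤ.+ n₂) ℤ.* + suc d₁ ℤ.≤ n₁ ℤ.* D) (sym D≡D₁+D₂)
        (mediant-cross n₁ n₂ (+ suc d₁) (+ suc d₂)
          (subst (λ D → n₂ ℤ.* D ℤ.≤ (n₁ ℤ.+ n₂) ℤ.* + suc d₂) D≡D₁+D₂ hyp)))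
  where
  D≡D₁+D₂ : + suc d ≡ + suc d₁ ℤ.+ + suc d₂
  D≡D₁+D₂ = trans (cong +_ d≡d₁+d₂) (ℤ.pos-+ (suc d₁) (suc d₂))

fromℚᵘ-mono-≤ : ∀ {p q} → p ℚᵘ.≤ q → fromℚᵘ p ℚ.≤ fromℚᵘ q
fromℚᵘ-mono-≤ {p} {q} p≤q = ℚ.toℚᵘ-cancel-≤
  (ℚᵘ.≤-respʳ-≃ (ℚᵘ.≃-sym (ℚ.toℚᵘ-fromℚᵘ q)) (ℚᵘ.≤-respˡ-≃ (ℚᵘ.≃-sym (ℚ.toℚᵘ-fromℚᵘ p)) p≤q))

fromℚᵘ-cancel-≤ : ∀ {p q} → fromℚᵘ p ℚ.≤ fromℚᵘ q → p ℚᵘ.≤ q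
fromℚᵘ-cancel-≤ {p} {q} p≤q =
  ℚᵘ.≤-respʳ-≃ (ℚ.toℚᵘ-fromℚᵘ q) (ℚᵘ.≤-respˡ-≃ (ℚ.toℚᵘ-fromℚᵘ p) (ℚ.toℚᵘ-mono-≤ p≤q))

mediant-squeeze : ∀ n₁ n₂ d₁ d₂ d → suc d ≡ suc d₁ ℕ.+ suc d₂ →
  n₁ ℚ./ suc d₁ ℚ.≤ (n₁ ℤ.+ n₂) ℚ./ suc d → n₂ ℚ./ suc d₂ ℚ.≤ (n₁ ℤ.+ n₂) ℚ./ suc d →
  n₁ ℚ./ suc d₁ ≡ (n₁ ℤ.+ n₂) ℚ./ suc d
mediant-squeeze n₁ n₂ d₁ d₂ d d≡d₁+d₂ ≤mediant₁ ≤mediant₂ = ℚ.≤-antisym ≤mediant₁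
  (fromℚᵘ-mono-≤ (mediant-≤ᵘ n₁ n₂ d₁ d₂ d d≡d₁+d₂ (fromℚᵘ-cancel-≤ ≤mediant₂)))

+-cancelʳ-≤ : ∀ r {p q} → p ℚ.+ r ℚ.≤ q ℚ.+ r → p ℚ.≤ q
+-cancelʳ-≤ r {p} {q} p+r≤q+r =
  subst₂ ℚ._≤_ (//-rightDividesʳ r p) (//-rightDividesʳ r q) (ℚ.+-monoˡ-≤ (ℚ.- r) p+r≤q+r)

φS-as-fraction : ∀ G b → IsOrientable G b → ∀ X → ∂ G X ≢ 0 →
  ∃ λ d → (+ suc d ≡ ∂ℤ G X ℤ.- bsum G b X) × (φS G b X ≡ (∂ℤ G X ℤ.+ bsum G b X) ℚ./ suc d ℚ.+ 1ℚ)
φS-as-fraction G b orientable X ∂X≢0 with ℤ.∣ ∂ℤ G X ℤ.- bsum G b X ∣ in ∣∂-b∣≡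
... | zero  = ⊥-elim (ℤ.<-irrefl (sym (ℤ.i-j≡0⇒i≡j _ _ (ℤ.∣i∣≡0⇒i≡0 ∣∂-b∣≡))) (orientable X ∂X≢0))
... | suc d =
  d , trans (cong +_ (sym ∣∂-b∣≡)) (ℤ.0≤i⇒+∣i∣≡i (ℤ.i≤j⇒0≤j-i (ℤ.<⇒≤ (orientable X ∂X≢0)))) , refl

module _ (G : Graph) (b : Fin (n G) → ℤ) {A B : Subset (n G)}
         (A∩B≡∅ : Empty (A ∩ B)) (separated : NoEdgeBetween A B (edges G)) where

  ∂ℤ-∪ : ∂ℤ G (A ∪ B) ≡ ∂ℤ G A ℤ.+ ∂ℤ G B
  ∂ℤ-∪ = trans (cong +_ (∂-∪ G A∩B≡∅ separated)) (ℤ.pos-+ (∂ G A) (∂ G B))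

  ∂+bsum-∪ : ∂ℤ G (A ∪ B) ℤ.+ bsum G b (A ∪ B) ≡ (∂ℤ G A ℤ.+ bsum G b A) ℤ.+ (∂ℤ G B ℤ.+ bsum G b B)
  ∂+bsum-∪ rewrite ∂ℤ-∪ | bsum-∪ G b A∩B≡∅ =
    CommSemigroup.interchange ℤ.+-commutativeSemigroup (∂ℤ G A) (∂ℤ G B) (bsum G b A) (bsum G b B)

  ∂-bsum-∪ : ∂ℤ G (A ∪ B) ℤ.- bsum G b (A ∪ B) ≡ (∂ℤ G A ℤ.- bsum G b A) ℤ.+ (∂ℤ G B ℤ.- bsum G b B)
  ∂-bsum-∪ rewrite ∂ℤ-∪ | bsum-∪ G b A∩B≡∅ = interchange-− (∂ℤ G A) (∂ℤ G B) (bsum G b A) (bsum G b B)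
    where
    open +-*-Solver
    interchange-− : ∀ a c x y → (a ℤ.+ c) ℤ.- (x ℤ.+ y) ≡ (a ℤ.- x) ℤ.+ (c ℤ.- y)
    interchange-− = solve 4 (λ a c x y → (a :+ c) :- (x :+ y) := (a :- x) :+ (c :- y)) refl

  ∂-∪≢0 : ∂ G A ≢ 0 → ∂ G (A ∪ B) ≢ 0
  ∂-∪≢0 ∂A≢0 = ∂A≢0 ∘ ℕ.m+n≡0⇒m≡0 (∂ G A) ∘ trans (sym (∂-∪ G A∩B≡∅ separated))

  φS≡φ-∪⇒φS≡φ : IsOrientable G b → ∂ G A ≢ 0 → ∂ G B ≢ 0 → φS G b (A ∪ B) ≡ φ G b → φS G b A ≡ φ G b
  φS≡φ-∪⇒φS≡φ orientable ∂A≢0 ∂B≢0 φS≡φ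
    with φS-as-fraction G b orientable A ∂A≢0
       | φS-as-fraction G b orientable B ∂B≢0
       | φS-as-fraction G b orientable (A ∪ B) (∂-∪≢0 ∂A≢0)
  ... | dA , DA , φA≡ | dB , DB , φB≡ | dS , DS , φS≡ = begin
    φS G b A                       ≡⟨ φA≡ ⟩
    NA ℚ./ suc dA ℚ.+ 1ℚ           ≡⟨ cong (ℚ._+ 1ℚ) (mediant-squeeze NA NB dA dB dS dS≡dA+dB A≤S B≤S) ⟩
    (NA ℤ.+ NB) ℚ./ suc dS ℚ.+ 1ℚ  ≡⟨ φS≡mediant ⟨
    φS G b (A ∪ B)                 ≡⟨ φS≡φ ⟩
    φ G b                          ∎
    where
    open ≡-Reasoning
    NA = ∂ℤ G A ℤ.+ bsum G b A
    NB = ∂ℤ G B ℤ.+ bsum G b B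
    φS≡mediant : φS G b (A ∪ B) ≡ (NA ℤ.+ NB) ℚ./ suc dS ℚ.+ 1ℚ
    φS≡mediant = trans φS≡ (cong (λ N → N ℚ./ suc dS ℚ.+ 1ℚ) ∂+bsum-∪)
    dS≡dA+dB : suc dS ≡ suc dA ℕ.+ suc dB
    dS≡dA+dB = ℤ.+-injective (begin
      + suc dS                                           ≡⟨ DS ⟩
      ∂ℤ G (A ∪ B) ℤ.- bsum G b (A ∪ B)                  ≡⟨ ∂-bsum-∪ ⟩
      (∂ℤ G A ℤ.- bsum G b A) ℤ.+ (∂ℤ G B ℤ.- bsum G b B) ≡⟨ cong₂ ℤ._+_ DA DB ⟨
      + suc dA ℤ.+ + suc dB                              ≡⟨ ℤ.pos-+ (suc dA) (suc dB) ⟨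
      + (suc dA ℕ.+ suc dB)                              ∎)
    below-mediant : ∀ X N d → ∂ G X ≢ 0 → φS G b X ≡ N ℚ./ suc d ℚ.+ 1ℚ →
                    N ℚ./ suc d ℚ.≤ (NA ℤ.+ NB) ℚ./ suc dS
    below-mediant X N d ∂X≢0 φX≡ = +-cancelʳ-≤ 1ℚ
      (subst₂ ℚ._≤_ φX≡ (trans (sym φS≡φ) φS≡mediant) (φS≤φ G b X ∂X≢0))
    A≤S = below-mediant A NA dA ∂A≢0 φA≡
    B≤S = below-mediant B NB dB ∂B≢0 φB≡

-- Balance and nonemptiness are unused: orientability alone makes each ∂(X) − b(X) positive.
lemma2 : (G : Graph) (b : Fin (n G) → ℤ) →
         IsBalancedValuation G b → IsOrientable G b →
         (S : Subset (n G)) → ∂ G S ≢ 0 → φS G b S ≡ φ G b →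
         (A B : Subset (n G)) →
         Empty (A ∩ B) → A ∪ B ≡ S → Nonempty A → Nonempty B →
         ∂ G A ≢ 0 → ∂ G B ≢ 0 →
         (∀ {u v} → (u , v) ∈ₗ edges G → ¬ ((u ∈ A × v ∈ B) ⊎ (u ∈ B × v ∈ A))) →
         (φS G b A ≡ φ G b) × (φS G b B ≡ φ G b)
lemma2 G b _ orientable .(A ∪ B) _ φS≡φ A B A∩B≡∅ refl _ _ ∂A≢0 ∂B≢0 separated =
  φS≡φ-∪⇒φS≡φ G b A∩B≡∅ separated orientable ∂A≢0 ∂B≢0 φS≡φ ,
  φS≡φ-∪⇒φS≡φ G b (subst Empty (∩-comm A B) A∩B≡∅) (λ uv∈E → separated uv∈E ∘ swap)
    orientable ∂B≢0 ∂A≢0 (subst (λ S → φS G b S ≡ φ G b) (∪-comm A B) φS≡φ)
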